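{- Let $L=(S,A,\to)$ be a labelled transition system. For all $x,y,z\in\{o,b\}$ and all $s,t\in S$: $s\leq_{(z,x)}t$ if and only if $s\leq_{(z,y)}t$.
   Context: LTS $L=(S,A,\to)$: states $S$, actions $A$ containing the internal action $\tau$, $\to\subseteq S\times A\times S$ written $s\xrightarrow{a}t$; $\twoheadrightarrow$ is the reflexive-transitive closure of $\xrightarrow{\tau}$. For $R\subseteq S\times S$ and $s,s',t\in S$: $s\twoheadrightarrow_{o,R,t}s'$ iff $s\twoheadrightarrow s'$; $s\twoheadrightarrow_{b,R,t}s'$ iff $s\twoheadrightarrow s'$, $t\,R\,s$ and $t\,R\,s'$. For $x,y\in\{o,b\}$, a (not necessarily symmetric) relation $R\subseteq S\times S$ is an $(x,y)$-generic simulation if whenever $s\,R\,t$ and $s\xrightarrow{a}s'$, either $a=\tau$ and $s'\,R\,t$, or there exist $t_1,t_2,t'$ with $t\twoheadrightarrow_{x,R,s}t_1\xrightarrow{a}t_2\twoheadrightarrow_{y,R,s'}t'$ and $s'\,R\,t'$. Write $s\leq_{(x,y)}t$ iff there is an $(x,y)$-generic simulation $R$ with $s\,R\,t$. -}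

module Defs where

open import Level using (Level; _⊔_; suc)
open import Data.Product using (Σ; ∃; _×_; _,_)
open import Data.Sum using (_⊎_)
open import Relation.Binary.PropositionalEquality using (_≡_)
open import Relation.Binary.Core using (Rel)
open import Relation.Binary.Construct.Closure.ReflexiveTransitive using (Star)

record LTS (ℓ : Level) : Set (suc ℓ) where
  field
    State  : Set ℓ
    Action : Set ℓ
    τ      : Action
    _⟶[_]_ : State → Action → State → Set ℓ

  _⟶τ_ : State → State → Set ℓ
  s ⟶τ t = s ⟶[ τ ] t

  _↠_ : State → State → Set ℓ
  _↠_ = Star _⟶τ_

data Mode : Set where
  o b : Mode

module _ {ℓ : Level} (L : LTS ℓ) where
  open LTS L

  ModeSteps : Mode → Rel State ℓ → State → State → State → Set ℓ
  ModeSteps o R t s s' = s ↠ s'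
  ModeSteps b R t s s' = (s ↠ s') × R t s × R t s'

  IsGenericSimulation : Mode → Mode → Rel State ℓ → Set ℓ
  IsGenericSimulation x y R =
    ∀ {s t s' a} → R s t → s ⟶[ a ] s' →
      ((a ≡ τ) × R s' t)
      ⊎ Σ State (λ t₁ → Σ State (λ t₂ → Σ State (λ t' →
          ModeSteps x R s t t₁ × (t₁ ⟶[ a ] t₂) × ModeSteps y R s' t₂ t' × R s' t')))

  GenSim≤ : Mode → Mode → State → State → Set (suc ℓ)
  GenSim≤ x y s t = Σ (Rel State ℓ) (λ R → IsGenericSimulation x y R × R s t)

-- The second mode only adds the conditions s' R t₂ and s' R t' on the τ-steps
-- t₂ ↠ t' after the answering transition. Dropping them turns a (z,b)-simulation into a
-- (z,o)-simulation. Conversely, closing a (z,o)-simulation R under τ-reachability on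
-- the right (s R' u iff s R t for some t with u ↠ t) makes them hold automatically,
-- since t₂ ↠ t' and s' R t'.
module Submission where

open import Defs
open import Level using (Level)
open import Function.Base using (id)
open import Function.Bundles using (_⇔_; mk⇔)
open import Data.Product using (Σ; _×_; _,_)
open import Data.Sum using (inj₁; inj₂)
open import Relation.Binary.Core using (Rel)
open import Relation.Binary.Construct.Closure.ReflexiveTransitive using (ε; _◅◅_)

module _ {ℓ : Level} (L : LTS ℓ) where
  open LTS L

  modeSteps⇒↠ : ∀ x {R t s s'} → ModeSteps L x R t s s' → s ↠ s'
  modeSteps⇒↠ o s↠s'           = s↠s'
  modeSteps⇒↠ b (s↠s' , _ , _) = s↠s'

  isGenericSimulation-b⇒o : ∀ {z R} → IsGenericSimulation L z b R → IsGenericSimulation L z o R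
  isGenericSimulation-b⇒o {R = R} sim sRt s⟶s' with sim sRt s⟶s'
  ... | inj₁ τ-step = inj₁ τ-step
  ... | inj₂ (t₁ , t₂ , t' , pre , t₁⟶t₂ , post , s'Rt') =
    inj₂ (t₁ , t₂ , t' , pre , t₁⟶t₂ , modeSteps⇒↠ b {R} post , s'Rt')

  τ-expand : Rel State ℓ → Rel State ℓ
  τ-expand R s u = Σ State (λ t → R s t × u ↠ t)

  modeSteps-τ-expand : ∀ x {R s t u t₁} → R s t → u ↠ t →
    ModeSteps L x R s t t₁ → ModeSteps L x (τ-expand R) s u t₁
  modeSteps-τ-expand o _ u↠t t↠t₁ = u↠t ◅◅ t↠t₁
  modeSteps-τ-expand b sRt u↠t (t↠t₁ , _ , sRt₁) =
    u↠t ◅◅ t↠t₁ , (_ , sRt , u↠t) , (_ , sRt₁ , ε)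

  isGenericSimulation-o⇒b : ∀ {z R} → IsGenericSimulation L z o R →
    IsGenericSimulation L z b (τ-expand R)
  isGenericSimulation-o⇒b {z} sim (t , sRt , u↠t) s⟶s' with sim sRt s⟶s'
  ... | inj₁ (a≡τ , s'Rt) = inj₁ (a≡τ , (t , s'Rt , u↠t))
  ... | inj₂ (t₁ , t₂ , t' , pre , t₁⟶t₂ , t₂↠t' , s'Rt') =
    inj₂ (t₁ , t₂ , t' , modeSteps-τ-expand z sRt u↠t pre , t₁⟶t₂ ,
          (t₂↠t' , (t' , s'Rt' , t₂↠t') , (t' , s'Rt' , ε)) , (t' , s'Rt' , ε))

  genSim≤-b⇒o : ∀ z {s t} → GenSim≤ L z b s t → GenSim≤ L z o s t
  genSim≤-b⇒o z (R , sim , sRt) = R , isGenericSimulation-b⇒o sim , sRt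

  genSim≤-o⇒b : ∀ z {s t} → GenSim≤ L z o s t → GenSim≤ L z b s t
  genSim≤-o⇒b z (R , sim , sRt) = τ-expand R , isGenericSimulation-o⇒b sim , (_ , sRt , ε)

  genSim≤-change-mode : ∀ z x y {s t} → GenSim≤ L z x s t → GenSim≤ L z y s t
  genSim≤-change-mode z o o = id
  genSim≤-change-mode z o b = genSim≤-o⇒b z
  genSim≤-change-mode z b o = genSim≤-b⇒o z
  genSim≤-change-mode z b b = id

proposition6p13 : {ℓ : Level} (L : LTS ℓ) (x y z : Mode) (s t : LTS.State L) →
    GenSim≤ L z x s t ⇔ GenSim≤ L z y s t
proposition6p13 L x y z s t = mk⇔ (genSim≤-change-mode L z x y) (genSim≤-change-mode L z y x)
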